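{- Let $k$ be an integer and let $G$ be a non-complete double-critical $k$-chromatic graph. Then every vertex of $G$ has at least $k+1$ neighbours.
   Context: All graphs are finite and simple. A graph $G$ is (vertex-)critical if $\chi(G-v)<\chi(G)$ for every vertex $v$. A critical graph $G$ is double-critical if $\chi(G-x-y)\le \chi(G)-2$ for every edge $xy\in E(G)$ (here $G-x-y$ denotes deletion of both end-vertices). -}

module Defs where

open import Data.Nat using (ℕ; suc; _<_; _≤_; _∸_)
open import Data.Fin using (Fin)
open import Data.Bool using (Bool; true; false; T)
open import Data.List using (List; filter; length)
open import Data.List using () renaming (allFin to allFinL)
open import Data.Product using (Σ; _×_; ∃)
open import Relation.Nullary using (¬_)
open import Relation.Binary.PropositionalEquality using (_≡_; _≢_)
open import Data.Bool.Properties using (T?)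

record Graph (n : ℕ) : Set where
  field
    adj   : Fin n → Fin n → Bool
    sym   : ∀ u v → adj u v ≡ adj v u
    irref : ∀ v → adj v v ≡ false

open Graph public

Adj : ∀ {n} → Graph n → Fin n → Fin n → Set
Adj G u v = T (adj G u v)

VSet : ℕ → Set
VSet n = Fin n → Bool

full : ∀ {n} → VSet n
full _ = true

ProperColouring : ∀ {n} → Graph n → VSet n → (c : ℕ) → (Fin n → Fin c) → Set
ProperColouring G S c f =
  ∀ u v → T (S u) → T (S v) → Adj G u v → f u ≢ f v

Colourable : ∀ {n} → Graph n → VSet n → ℕ → Set
Colourable G S c = Σ (Fin _ → Fin c) (ProperColouring G S c)

IsChromatic : ∀ {n} → Graph n → VSet n → ℕ → Set
IsChromatic G S m = Colourable G S m × (∀ c → c < m → ¬ Colourable G S c)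

del1 : ∀ {n} → Fin n → VSet n
del1 {n} v w with w Data.Fin.≟ v
... | Relation.Nullary.yes _ = false
... | Relation.Nullary.no _  = true

del2 : ∀ {n} → Fin n → Fin n → VSet n
del2 x y w with w Data.Fin.≟ x | w Data.Fin.≟ y
... | Relation.Nullary.no _ | Relation.Nullary.no _ = true
... | _ | _ = false

KChromatic : ∀ {n} → Graph n → ℕ → Set
KChromatic G k = IsChromatic G full k

Critical : ∀ {n} → Graph n → Set
Critical {n} G = ∃ λ k → KChromatic G k ×
  (∀ (v : Fin n) → ∃ λ m → IsChromatic G (del1 v) m × m < k)

DoubleCritical : ∀ {n} → Graph n → Set
DoubleCritical {n} G = Critical G ×
  (∀ k → KChromatic G k → ∀ (x y : Fin n) → Adj G x y →
     ∃ λ m → IsChromatic G (del2 x y) m × m ≤ k ∸ 2)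

Complete : ∀ {n} → Graph n → Set
Complete {n} G = ∀ (u v : Fin n) → u ≢ v → Adj G u v

degree : ∀ {n} → Graph n → Fin n → ℕ
degree {n} G v = length (filter (λ u → T? (adj G v u)) (allFinL n))

module Submission where

-- Write k = j + 2 (k ≤ 1 is impossible as G has a vertex).  Then G is not
-- (j+1)-colourable, every G - u is (j+1)-colourable, and every G - x - y with
-- xy an edge is j-colourable.  Key lemma (recolouring): every colour class of
-- a j-colouring of G - x - y contains a common neighbour of x and y, since
-- otherwise x could take that colour c while y and the c-coloured neighbours
-- of x take one new colour.  So adjacent x, y have j common neighbours.
--
-- If some x had at most j + 2 neighbours, counting shows N(x) is a clique; a
-- neighbour y of x with their common neighbours forms a (j+2)-clique meeting
-- every vertex u ≠ x (G - u is (j+1)-colourable), so G would be complete; and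
-- an isolated x would let a colouring of G - x colour G.

open import Defs
open import Data.Nat using (ℕ; zero; suc; _+_; _≤_; _≤?_; s≤s⁻¹)
open import Data.Nat.Properties using (≰⇒>; ≤⇒≯; n<1+n; 1+n≰n; <-cmp)
open import Data.Fin using (Fin; zero; suc; inject₁; fromℕ; inject≤; _≟_)
open import Data.Fin.Properties
  using (injective⇒≤; any?; fromℕ≢inject₁; inject₁-injective; inject≤-injective)
open import Data.Vec.Functional using (_∷_)
open import Data.Bool using (T)
open import Data.Bool.Properties using (T?)
open import Data.Unit using (tt)
open import Data.Empty using (⊥; ⊥-elim)
open import Data.Product using (_×_; _,_; proj₁; ∃)
open import Data.Sum using (_⊎_; inj₁; inj₂)
open import Data.List using (filter; lookup; allFin)
open import Data.List.Membership.Propositional using (_∈_)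
open import Data.List.Membership.Propositional.Properties using (∈-filter⁺; ∈-allFin)
open import Data.List.Relation.Unary.Any using (index)
open import Data.List.Relation.Unary.Any.Properties using (lookup-index)
open import Function using (_∘_)
open import Function.Definitions using (Injective)
open import Relation.Nullary using (¬_; yes; no)
open import Relation.Nullary.Decidable using (_×-dec_)
open import Relation.Binary using (tri<; tri≈; tri>)
open import Relation.Binary.PropositionalEquality
  using (_≡_; _≢_; refl; cong; subst; trans; ≢-sym; module ≡-Reasoning)
  renaming (sym to ≡-sym)

∷-injective : ∀ {A : Set} {m} {w : A} {f : Fin m → A} →
  (∀ i → w ≢ f i) → Injective _≡_ _≡_ f → Injective _≡_ _≡_ (w ∷ f)
∷-injective new inj {zero}  {zero}   _ = refl
∷-injective new inj {zero}  {suc i′} e = ⊥-elim (new i′ e)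
∷-injective new inj {suc i} {zero}   e = ⊥-elim (new i (≡-sym e))
∷-injective new inj {suc i} {suc i′} e = cong suc (inj e)

∈-del1 : ∀ {n} {x w : Fin n} → w ≢ x → T (del1 x w)
∈-del1 {x = x} {w} w≢x with w ≟ x
... | yes w≡x = ⊥-elim (w≢x w≡x)
... | no _    = tt

∈-del2 : ∀ {n} {x y w : Fin n} → w ≢ x → w ≢ y → T (del2 x y w)
∈-del2 {x = x} {y} {w} w≢x w≢y with w ≟ x | w ≟ y
... | yes w≡x | _       = ⊥-elim (w≢x w≡x)
... | no _    | yes w≡y = ⊥-elim (w≢y w≡y)
... | no _    | no _    = tt

module _ {n : ℕ} (G : Graph n) where

  adj-sym : ∀ {u v} → Adj G u v → Adj G v u
  adj-sym {u} {v} = subst T (Graph.sym G u v)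

  adj⇒≢ : ∀ {u v} → Adj G u v → u ≢ v
  adj⇒≢ {u} u~u refl = subst T (irref G u) u~u

  colourable-mono : ∀ {S m c} → m ≤ c → Colourable G S m → Colourable G S c
  colourable-mono m≤c (f , proper) =
    (λ v → inject≤ (f v) m≤c) ,
    λ u v u∈S v∈S u~v e → proper u v u∈S v∈S u~v (inject≤-injective m≤c m≤c (f u) (f v) e)

  no-zero-colouring : ∀ {S} → Fin n → ¬ Colourable G S 0
  no-zero-colouring v (f , _) with f v
  ... | ()

  chromatic-unique : ∀ {S a b} → IsChromatic G S a → IsChromatic G S b → a ≡ b
  chromatic-unique {a = a} {b} (col-a , min-a) (col-b , min-b) with <-cmp a b
  ... | tri< a<b _ _ = ⊥-elim (min-b a a<b col-a)
  ... | tri≈ _ a≡b _ = a≡b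
  ... | tri> _ _ b<a = ⊥-elim (min-a b b<a col-b)

  isolated-extension : ∀ {x c} → (∀ w → ¬ Adj G x w) →
    Colourable G (del1 x) c → Colourable G full c
  isolated-extension iso (f , proper) =
    f , λ u v _ _ u~v → proper u v
          (∈-del1 λ { refl → iso v u~v })
          (∈-del1 λ { refl → iso u (adj-sym u~v) }) u~v

  IsClique : ∀ {m} → (Fin m → Fin n) → Set
  IsClique h = ∀ i i′ → i ≢ i′ → Adj G (h i) (h i′)

  ∷-clique : ∀ {m w} {h : Fin m → Fin n} →
    (∀ i → Adj G w (h i)) → IsClique h → IsClique (w ∷ h)
  ∷-clique w~h clique zero    zero     0≢0 = ⊥-elim (0≢0 refl)
  ∷-clique w~h clique zero    (suc i′) _   = w~h i′
  ∷-clique w~h clique (suc i) zero     _   = adj-sym (w~h i)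
  ∷-clique w~h clique (suc i) (suc i′) i≢i′ = clique i i′ (i≢i′ ∘ cong suc)

  clique≤colours : ∀ {S m c} (h : Fin m → Fin n) → IsClique h →
    (∀ i → T (S (h i))) → Colourable G S c → m ≤ c
  clique≤colours h clique h∈S (f , proper) = injective⇒≤ colours-distinct
    where
    colours-distinct : Injective _≡_ _≡_ (f ∘ h)
    colours-distinct {i} {i′} e with i ≟ i′
    ... | yes i≡i′ = i≡i′
    ... | no i≢i′  = ⊥-elim (proper (h i) (h i′) (h∈S i) (h∈S i′) (clique i i′ i≢i′) e)

  -- An injective family of neighbours of x has at most degree G x members:
  -- positions in the list of neighbours are distinct.
  neighbours≤degree : ∀ {m x} (f : Fin m → Fin n) → (∀ i → Adj G x (f i)) →
    Injective _≡_ _≡_ f → m ≤ degree G x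
  neighbours≤degree {x = x} f x~f f-injective = injective⇒≤ position-injective
    where
    N = filter (λ u → T? (adj G x u)) (allFin n)

    listed : ∀ i → f i ∈ N
    listed i = ∈-filter⁺ (λ u → T? (adj G x u)) (∈-allFin (f i)) (x~f i)

    position-injective : Injective _≡_ _≡_ (λ i → index (listed i))
    position-injective {i} {i′} e = f-injective (begin
      f i                        ≡⟨ lookup-index (listed i) ⟩
      lookup N (index (listed i))  ≡⟨ cong (lookup N) e ⟩
      lookup N (index (listed i′)) ≡⟨ lookup-index (listed i′) ⟨
      f i′                       ∎)
      where open ≡-Reasoning

  -- Given a proper j-colouring φ of G - x - y and a colour
  -- c such that no c-coloured vertex is adjacent to both x and y, x takes
  -- colour c, while y and the c-coloured neighbours of x take a new colour.
  module Recolouring {j} {x y : Fin n} (φ : Fin n → Fin j)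
    (φ-proper : ProperColouring G (del2 x y) j φ) (c : Fin j)
    (no-common : ∀ w → φ w ≡ c → Adj G x w → Adj G y w → ⊥) where

    Moved : Fin n → Set
    Moved v = v ≡ y ⊎ (v ≢ y × φ v ≡ c × Adj G x v)

    data Role (v : Fin n) : Set where
      is-x  : v ≡ x → Role v
      moved : v ≢ x → Moved v → Role v
      kept  : v ≢ x → v ≢ y → ¬ (φ v ≡ c × Adj G x v) → Role v

    role : ∀ v → Role v
    role v with v ≟ x | v ≟ y | (φ v ≟ c) ×-dec T? (adj G x v)
    ... | yes v≡x | _       | _                = is-x v≡x
    ... | no v≢x  | yes v≡y | _                = moved v≢x (inj₁ v≡y)
    ... | no v≢x  | no v≢y  | yes c-neighbour  = moved v≢x (inj₂ (v≢y , c-neighbour))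
    ... | no v≢x  | no v≢y  | no ¬c-neighbour  = kept v≢x v≢y ¬c-neighbour

    paint : ∀ v → Role v → Fin (suc j)
    paint v (is-x _)     = inject₁ c
    paint v (moved _ _)  = fromℕ j
    paint v (kept _ _ _) = inject₁ (φ v)

    -- The moved vertices are independent: y has no c-coloured neighbour of
    -- x as neighbour, and the others share the colour c in G - x - y.
    moved-independent : ∀ {u v} → Moved u → Moved v → ¬ Adj G u v
    moved-independent (inj₁ refl) (inj₁ refl) y~y = adj⇒≢ y~y refl
    moved-independent (inj₁ refl) (inj₂ (_ , φv≡c , x~v)) y~v = no-common _ φv≡c x~v y~v
    moved-independent (inj₂ (_ , φu≡c , x~u)) (inj₁ refl) u~y =
      no-common _ φu≡c x~u (adj-sym u~y)
    moved-independent (inj₂ (u≢y , φu≡c , x~u)) (inj₂ (v≢y , φv≡c , x~v)) u~v =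
      φ-proper _ _ (∈-del2 (≢-sym (adj⇒≢ x~u)) u≢y) (∈-del2 (≢-sym (adj⇒≢ x~v)) v≢y)
        u~v (trans φu≡c (≡-sym φv≡c))

    paint-proper : ∀ {u v} (ru : Role u) (rv : Role v) → Adj G u v → paint u ru ≢ paint v rv
    paint-proper (is-x refl)  (is-x refl)  x~x _ = adj⇒≢ x~x refl
    paint-proper (is-x refl)  (moved _ _)  _   e = fromℕ≢inject₁ (≡-sym e)
    paint-proper (is-x refl)  (kept _ _ ¬c-neighbour) x~v e =
      ¬c-neighbour (≡-sym (inject₁-injective e) , x~v)
    paint-proper (moved _ _)  (is-x _)     _   e = fromℕ≢inject₁ e
    paint-proper (moved _ mu) (moved _ mv) u~v _ = moved-independent mu mv u~v
    paint-proper (moved _ _)  (kept _ _ _) _   e = fromℕ≢inject₁ e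
    paint-proper (kept _ _ ¬c-neighbour) (is-x refl) u~x e =
      ¬c-neighbour (inject₁-injective e , adj-sym u~x)
    paint-proper (kept _ _ _) (moved _ _)  _   e = fromℕ≢inject₁ (≡-sym e)
    paint-proper (kept u≢x u≢y _) (kept v≢x v≢y _) u~v e =
      φ-proper _ _ (∈-del2 u≢x u≢y) (∈-del2 v≢x v≢y) u~v (inject₁-injective e)

    recoloured : Colourable G full (suc j)
    recoloured = (λ v → paint v (role v)) , λ u v _ _ → paint-proper (role u) (role v)

  common-neighbour-in-class : ∀ {j x y} → ¬ Colourable G full (suc j) →
    (φ : Fin n → Fin j) → ProperColouring G (del2 x y) j φ →
    ∀ c → ∃ λ w → φ w ≡ c × Adj G x w × Adj G y w
  common-neighbour-in-class {x = x} {y} not-colourable φ φ-proper c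
    with any? (λ w → (φ w ≟ c) ×-dec (T? (adj G x w) ×-dec T? (adj G y w)))
  ... | yes found = found
  ... | no none   = ⊥-elim (not-colourable
          (Recolouring.recoloured φ φ-proper c (λ w φw≡c x~w y~w → none (w , φw≡c , x~w , y~w))))

  record CommonNeighbours (j : ℕ) (x y : Fin n) : Set where
    field
      member      : Fin j → Fin n
      injective   : Injective _≡_ _≡_ member
      x~member    : ∀ c → Adj G x (member c)
      y~member    : ∀ c → Adj G y (member c)

  -- Picking one common neighbour in each colour class gives j distinct ones.
  common-neighbours : ∀ {j x y} → ¬ Colourable G full (suc j) →
    Colourable G (del2 x y) j → CommonNeighbours j x y
  common-neighbours not-colourable (φ , φ-proper) = record
    { member    = λ c → proj₁ (pick c)
    ; injective = λ {c} {c′} e → trans (≡-sym (colour c)) (trans (cong φ e) (colour c′))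
    ; x~member  = λ c → let (_ , _ , x~w , _) = pick c in x~w
    ; y~member  = λ c → let (_ , _ , _ , y~w) = pick c in y~w
    }
    where
    pick = common-neighbour-in-class not-colourable φ φ-proper
    colour : ∀ c → φ (proj₁ (pick c)) ≡ c
    colour c = let (_ , φw≡c , _) = pick c in φw≡c

module DoubleCriticalStructure {n} (G : Graph n) (j : ℕ)
  (not-colourable : ¬ Colourable G full (suc j))
  (vertex-deleted : ∀ u → Colourable G (del1 u) (suc j))
  (edge-deleted : ∀ x y → Adj G x y → Colourable G (del2 x y) j) where

  three-beyond-common : ∀ {x y z₁ z₂} → Adj G x y → Adj G x z₁ → Adj G x z₂ →
    y ≢ z₁ → y ≢ z₂ → z₁ ≢ z₂ → ¬ Adj G y z₁ → ¬ Adj G y z₂ → 3 + j ≤ degree G x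
  three-beyond-common {x} {y} {z₁} {z₂} x~y x~z₁ x~z₂ y≢z₁ y≢z₂ z₁≢z₂ ¬y~z₁ ¬y~z₂ =
    neighbours≤degree G (y ∷ z₁ ∷ z₂ ∷ member) x~family
      (∷-injective y-new (∷-injective z₁-new (∷-injective (not-common ¬y~z₂) injective)))
    where
    open CommonNeighbours (common-neighbours G not-colourable (edge-deleted x y x~y))

    not-common : ∀ {z} → ¬ Adj G y z → ∀ c → z ≢ member c
    not-common ¬y~z c refl = ¬y~z (y~member c)

    z₁-new : ∀ i → z₁ ≢ (z₂ ∷ member) i
    z₁-new zero    = z₁≢z₂
    z₁-new (suc c) = not-common ¬y~z₁ c

    y-new : ∀ i → y ≢ (z₁ ∷ z₂ ∷ member) i
    y-new zero          = y≢z₁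
    y-new (suc zero)    = y≢z₂
    y-new (suc (suc c)) = adj⇒≢ G (y~member c)

    x~family : ∀ i → Adj G x ((y ∷ z₁ ∷ z₂ ∷ member) i)
    x~family zero                = x~y
    x~family (suc zero)          = x~z₁
    x~family (suc (suc zero))    = x~z₂
    x~family (suc (suc (suc c))) = x~member c

  module LowDegree (x : Fin n) (low : degree G x ≤ 2 + j) where

    -- Two non-adjacent neighbours z₁, z₂ of x are impossible: in a
    -- j-colouring φ of G - x - z₁, the class of z₂ contains a common
    -- neighbour w of x and z₁, and then z₁, w are neighbours of x not
    -- adjacent to z₂.
    non-adjacent-neighbours : ∀ {z₁ z₂} → Adj G x z₁ → Adj G x z₂ → z₁ ≢ z₂ →
      ¬ Adj G z₁ z₂ → ⊥
    non-adjacent-neighbours {z₁} {z₂} x~z₁ x~z₂ z₁≢z₂ ¬z₁~z₂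
      with edge-deleted x z₁ x~z₁
    ... | φ , φ-proper with common-neighbour-in-class G not-colourable φ φ-proper (φ z₂)
    ... | w , φw≡φz₂ , x~w , z₁~w =
      ≤⇒≯ low (three-beyond-common x~z₂ x~z₁ x~w (≢-sym z₁≢z₂) z₂≢w
                 (adj⇒≢ G z₁~w) (¬z₁~z₂ ∘ adj-sym G) ¬z₂~w)
      where
      z₂≢w : z₂ ≢ w
      z₂≢w refl = ¬z₁~z₂ z₁~w

      ¬z₂~w : ¬ Adj G z₂ w
      ¬z₂~w z₂~w = φ-proper z₂ w
        (∈-del2 (≢-sym (adj⇒≢ G x~z₂)) (≢-sym z₁≢z₂))
        (∈-del2 (≢-sym (adj⇒≢ G x~w)) (≢-sym (adj⇒≢ G z₁~w)))
        z₂~w (≡-sym φw≡φz₂)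

    neighbourhood-clique : ∀ {z₁ z₂} → Adj G x z₁ → Adj G x z₂ → z₁ ≢ z₂ → Adj G z₁ z₂
    neighbourhood-clique {z₁} {z₂} x~z₁ x~z₂ z₁≢z₂ with T? (adj G z₁ z₂)
    ... | yes z₁~z₂ = z₁~z₂
    ... | no ¬z₁~z₂ = ⊥-elim (non-adjacent-neighbours x~z₁ x~z₂ z₁≢z₂ ¬z₁~z₂)

    -- If x has a neighbour y, then x, y and their j common neighbours form a
    -- (j+2)-clique; it avoids any non-neighbour u ≠ x of x, contradicting the
    -- (j+1)-colourability of G - u.
    dominating : ∀ {y} → Adj G x y → ∀ u → u ≢ x → Adj G x u
    dominating {y} x~y u u≢x with T? (adj G x u)
    ... | yes x~u = x~u
    ... | no ¬x~u = ⊥-elim (1+n≰n (clique≤colours G (x ∷ y ∷ member) clique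
                                      avoids-u (vertex-deleted u)))
      where
      open CommonNeighbours (common-neighbours G not-colourable (edge-deleted x y x~y))

      x~others : ∀ i → Adj G x ((y ∷ member) i)
      x~others zero    = x~y
      x~others (suc c) = x~member c

      clique : IsClique G (x ∷ y ∷ member)
      clique = ∷-clique G x~others (∷-clique G y~member λ c c′ c≢c′ →
        neighbourhood-clique (x~member c) (x~member c′) (c≢c′ ∘ injective))

      avoids-u : ∀ i → T (del1 u ((x ∷ y ∷ member) i))
      avoids-u zero    = ∈-del1 (≢-sym u≢x)
      avoids-u (suc i) = ∈-del1 λ { refl → ¬x~u (x~others i) }

    -- If x is isolated, a colouring of G - x colours G; otherwise x is
    -- adjacent to all other vertices and N(x) is a clique, so G is complete.
    low-degree-impossible : ¬ Complete G → ⊥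
    low-degree-impossible ¬complete with any? (λ w → T? (adj G x w))
    ... | no isolated =
      not-colourable (isolated-extension G (λ w x~w → isolated (w , x~w)) (vertex-deleted x))
    ... | yes (y , x~y) = ¬complete complete
      where
      complete : Complete G
      complete u v u≢v with u ≟ x | v ≟ x
      ... | yes refl | _        = dominating x~y v (≢-sym u≢v)
      ... | no u≢x   | yes refl = adj-sym G (dominating x~y u u≢x)
      ... | no u≢x   | no v≢x   =
        neighbourhood-clique (dominating x~y u u≢x) (dominating x~y v v≢x) u≢v

  minimum-degree : ¬ Complete G → ∀ x → 3 + j ≤ degree G x
  minimum-degree ¬complete x with 3 + j ≤? degree G x
  ... | yes enough = enough
  ... | no few     = ⊥-elim (LowDegree.low-degree-impossible x (s≤s⁻¹ (≰⇒> few)) ¬complete)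

module _ {n} (G : Graph n) {c : ℕ} where

  below-chromatic : KChromatic G (suc c) → ¬ Colourable G full c
  below-chromatic (_ , minimal) = minimal c (n<1+n c)

  vertex-deleted-colourable : KChromatic G (suc c) → Critical G →
    ∀ u → Colourable G (del1 u) c
  vertex-deleted-colourable χG (_ , χG′ , critical) u
    with chromatic-unique G χG χG′ | critical u
  ... | refl | _ , (colouring , _) , m<k = colourable-mono G (s≤s⁻¹ m<k) colouring

  edge-deleted-colourable : KChromatic G (suc (suc c)) → DoubleCritical G →
    ∀ x y → Adj G x y → Colourable G (del2 x y) c
  edge-deleted-colourable χG (_ , double-critical) x y x~y
    with double-critical _ χG x y x~y
  ... | _ , (colouring , _) , m≤c = colourable-mono G m≤c colouring

-- k = 0 and k = 1 are impossible since G, respectively G - v, would be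
-- coloured with no colours; for k = j + 2 apply minimum-degree.
proposition11 : ∀ (n k : ℕ) (G : Graph n) → ¬ Complete G → DoubleCritical G →
    KChromatic G k → ∀ (v : Fin n) → suc k ≤ degree G v
proposition11 n zero G _ _ χG v = ⊥-elim (no-zero-colouring G v (proj₁ χG))
proposition11 n (suc zero) G _ (critical , _) χG v =
  ⊥-elim (no-zero-colouring G v (vertex-deleted-colourable G χG critical v))
proposition11 n (suc (suc j)) G ¬complete double-critical χG v = minimum-degree ¬complete v
  where
  open DoubleCriticalStructure G j (below-chromatic G χG)
    (vertex-deleted-colourable G χG (proj₁ double-critical))
    (edge-deleted-colourable G χG double-critical)
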